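{- Let $\tau\ge10$. Let $C$ be a minimal multilinear $\Sigma^k\Pi\Sigma$ circuit, and let $(C_1,\ldots,C_s)$ be a $(\tau,r_C)$-syntactic partition of the multiplication gates of $C$ that has the largest number of clusters among all $\tau$-syntactic partitions of $C$. Then for every other $(\tau,r_D)$-syntactic partition $(D_1,\ldots,D_{s'})$ of $C$ we have $r_C\le r_D$.
   Context: A $\Sigma^k\Pi\Sigma$ circuit is $C=\sum_{i=1}^kM_i$ with $M_i=\prod_{j}\ell_{i,j}$, $\ell_{i,j}$ affine linear functions; it is multilinear if each $M_i$ computes a multilinear polynomial, and minimal if no nonempty proper subset of the $M_i$ sums to the zero polynomial. $\gcd(C)$ is the product of linear functions (up to scalars) dividing every $M_i$; $\Delta_{\mathrm{syn}}(C)$ is the dimension of the span of the linear functions appearing in the gates $M_i/\gcd(C)$. $\mathrm{dist}(C,C')=\Delta_{\mathrm{syn}}(C+C')$, where $C+C'$ has the gates of both circuits. For a partition $A_1,\ldots,A_s$ of $[k]$ and $C_i=\sum_{j\in A_i}M_j$, $(C_1,\ldots,C_s)$ is a $(\tau,r)$-syntactic partition if $\Delta_{\mathrm{syn}}(C_i)\le r$ for all $i$ and $\mathrm{dist}(C_i,C_j)\ge\tau r$ for $i\neq j$; a $\tau$-syntactic partition is a $(\tau,r)$-syntactic partition for some $r$.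
   Formalization: The parameter τ, with τ ≥ 10, ranges over the rationals. -}

module Defs where

open import Level using (Level; _⊔_) renaming (suc to lsuc)
open import Algebra.Bundles using (CommutativeRing)
open import Data.Nat as ℕ using (ℕ; zero; suc; _≤_)
open import Data.Fin as Fin using (Fin; _≟_)
open import Data.Vec.Functional using (updateAt)
open import Data.Bool using (Bool; true; false; if_then_else_; _∨_)
open import Data.List using (List; []; _∷_; _++_; length; lookup)
open import Data.List.Relation.Unary.All using (All)
open import Data.List.Relation.Unary.Any using (Any)
open import Data.List.Relation.Binary.Permutation.Propositional using (_↭_)
open import Data.List.Relation.Binary.Pointwise using (Pointwise)
open import Data.Product using (Σ; ∃; ∃-syntax; _×_; _,_)
open import Data.Integer using (+_)
open import Data.Rational as ℚ using (ℚ; _/_)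
open import Relation.Nullary using (¬_; does)
open import Relation.Binary.PropositionalEquality using (_≡_; _≢_)
open import Function using (_∘_; _⇔_)

record Field (c ℓ : Level) : Set (lsuc (c ⊔ ℓ)) where
  field
    commutativeRing : CommutativeRing c ℓ
  open CommutativeRing commutativeRing public
  field
    1#≉0#   : ¬ (1# ≈ 0#)
    inverse : ∀ x → ¬ (x ≈ 0#) → ∃[ y ] (x * y ≈ 1#)

ℕtoℚ : ℕ → ℚ
ℕtoℚ m = + m / 1

module Circuits {c ℓ : Level} (F : Field c ℓ) (n : ℕ) where
  open Field F

  sumF : ∀ {m} → (Fin m → Carrier) → Carrier
  sumF {zero}  f = 0#
  sumF {suc m} f = f Fin.zero + sumF (f ∘ Fin.suc)

  -- affine linear function a_0 + Σ_i a_{i+1} x_i, as its coefficient vector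
  Affine : Set c
  Affine = Fin (suc n) → Carrier

  -- polynomials in n variables, given by their coefficient function on
  -- exponent vectors (monomials)
  Monomial : Set
  Monomial = Fin n → ℕ

  Poly : Set c
  Poly = Monomial → Carrier

  onePoly : Poly
  onePoly = go
    where
    go : ∀ {m} → (Fin m → ℕ) → Carrier
    go {zero}  e = 1#
    go {suc m} e with e Fin.zero
    ... | zero  = go (e ∘ Fin.suc)
    ... | suc _ = 0#

  mulAff : Affine → Poly → Poly
  mulAff a P e = a Fin.zero * P e + sumF term
    where
    term : Fin n → Carrier
    term i with e i
    ... | zero  = 0#
    ... | suc t = a (Fin.suc i) * P (updateAt e i (λ _ → t))

  Gate : Set c
  Gate = List Affine

  gatePoly : Gate → Poly
  gatePoly []      = onePoly
  gatePoly (a ∷ g) = mulAff a (gatePoly g)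

  Circuit : ℕ → Set c
  Circuit k = Fin k → Gate

  IsZeroPoly : Poly → Set ℓ
  IsZeroPoly P = ∀ e → P e ≈ 0#

  Multilinear : Poly → Set ℓ
  Multilinear P = ∀ e i → 2 ≤ e i → P e ≈ 0#

  -- sub-circuits are given by a selector (a subset of the gates)
  Selector : ℕ → Set
  Selector k = Fin k → Bool

  subPoly : ∀ {k} → Circuit k → Selector k → Poly
  subPoly C S e = sumF (λ j → if S j then gatePoly (C j) e else 0#)

  IsMultilinearCircuit : ∀ {k} → Circuit k → Set ℓ
  IsMultilinearCircuit C = ∀ j → Multilinear (gatePoly (C j))

  IsMinimal : ∀ {k} → Circuit k → Set ℓ
  IsMinimal {k} C = ∀ (S : Selector k) → (∃[ j ] S j ≡ true) → (∃[ j ] S j ≡ false)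
                    → ¬ IsZeroPoly (subPoly C S)

  lincomb : (L : List Affine) → (Fin (length L) → Carrier) → Affine
  lincomb L cs t = sumF (λ a → cs a * lookup L a t)

  InSpan : Affine → List Affine → Set (c ⊔ ℓ)
  InSpan v L = ∃[ cs ] (∀ t → v t ≈ lincomb L cs t)

  LinIndep : List Affine → Set (c ⊔ ℓ)
  LinIndep B = ∀ cs → (∀ t → lincomb B cs t ≈ 0#) → ∀ a → cs a ≈ 0#

  SpanDim : List Affine → ℕ → Set (c ⊔ ℓ)
  SpanDim L d = ∃[ B ] (length B ≡ d × LinIndep B
                        × All (λ b → InSpan b L) B × All (λ v → InSpan v B) L)

  Assoc : Affine → Affine → Set (c ⊔ ℓ)
  Assoc l₁ l₂ = ∃[ s ] (¬ (s ≈ 0#) × ∀ t → l₁ t ≈ s * l₂ t)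

  -- equality of multisets of affine functions up to scalars
  _≈ₘ_ : List Affine → List Affine → Set (c ⊔ ℓ)
  L₁ ≈ₘ L₂ = ∃[ L ] (L₁ ↭ L × Pointwise Assoc L L₂)

  IsConst : Affine → Set ℓ
  IsConst a = ∀ i → a (Fin.suc i) ≈ 0#

  NonConst : Affine → Set ℓ
  NonConst a = ¬ IsConst a

  collect : ∀ {k} → Selector k → (Fin k → List Affine) → List Affine
  collect {zero}  S R = []
  collect {suc k} S R =
    (if S Fin.zero then R Fin.zero else []) ++ collect (S ∘ Fin.suc) (R ∘ Fin.suc)

  -- G is gcd of the selected gates (as a multiset of non-constant affine
  -- functions up to scalars), R j is the non-constant part of gate j / G,
  -- K j collects the constant factors of gate j.
  IsGcdDecomposition : ∀ {k} → Circuit k → Selector k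
                       → List Affine → (Fin k → List Affine) → Set (c ⊔ ℓ)
  IsGcdDecomposition {k} C S G R =
      All NonConst G
    × (∀ j → S j ≡ true → All NonConst (R j))
    × (∀ j → S j ≡ true →
         ∃[ K ] (All IsConst K × C j ≈ₘ (G ++ (R j ++ K))))
    × (¬ (∃[ l ] (∀ j → S j ≡ true → Any (Assoc l) (R j))))

  SynRank : ∀ {k} → Circuit k → Selector k → ℕ → Set (c ⊔ ℓ)
  SynRank C S d = ∃[ G ] ∃[ R ] (IsGcdDecomposition C S G R × SpanDim (collect S R) d)

  -- partitions of the gates: p j = index of the cluster containing gate j

  Surjective : ∀ {k s} → (Fin k → Fin s) → Set
  Surjective {k} {s} p = ∀ (i : Fin s) → ∃[ j ] p j ≡ i

  cluster : ∀ {k s} → (Fin k → Fin s) → Fin s → Selector k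
  cluster p i j = does (p j ≟ i)

  clusterPair : ∀ {k s} → (Fin k → Fin s) → Fin s → Fin s → Selector k
  clusterPair p i i' j = does (p j ≟ i) ∨ does (p j ≟ i')

  IsSyntacticPartition : ∀ {k s} → Circuit k → ℚ → ℕ → (Fin k → Fin s) → Set (c ⊔ ℓ)
  IsSyntacticPartition {k} {s} C τ r p =
      Surjective p
    × (∀ i → ∃[ d ] (SynRank C (cluster p i) d × d ≤ r))
    × (∀ i i' → i ≢ i' →
         ∃[ d ] (SynRank C (clusterPair p i i') d × τ ℚ.* ℕtoℚ r ℚ.≤ ℕtoℚ d))

  IsτSyntacticPartition : ∀ {k s} → Circuit k → ℚ → (Fin k → Fin s) → Set (c ⊔ ℓ)
  IsτSyntacticPartition C τ p = ∃[ r ] IsSyntacticPartition C τ r p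

  SamePartition : ∀ {k s s'} → (Fin k → Fin s) → (Fin k → Fin s') → Set
  SamePartition p p' = ∀ a b → (p a ≡ p b) ⇔ (p' a ≡ p' b)

module Submission where

-- Suppose rD < rC. If gates a, b share a cluster Q of q but lie in different clusters Pᵢ ∋ a,
-- Pⱼ ∋ b of p, then Δ_syn(Pᵢ + Pⱼ) ≤ Δ_syn(Pᵢ) + Δ_syn(Q) + Δ_syn(Pⱼ) ≤ 2 rC + rD < 3 rC ≤ τ rC,
-- contradicting dist(Pᵢ, Pⱼ) ≥ τ rC. The rank bound holds because a linear factor x of a gate
-- m ∈ Pᵢ that survives removing gcd(Pᵢ + Pⱼ) also survives removing gcd(Pᵢ) from m, gcd(Q) from a
-- or gcd(Pⱼ) from b. Indeed, let μ be the multiplicity of x up to scalars: some gate g of Pᵢ + Pⱼ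
-- has μ(g) = μ(gcd(Pᵢ + Pⱼ)) < μ(m), whereas if x survived none of the three removals then
-- μ(m) = μ(gcd Pᵢ) ≤ μ(a) = μ(gcd Q) ≤ μ(b) = μ(gcd Pⱼ), and g lies in Pᵢ or Pⱼ, so μ(m) ≤ μ(g).
-- Hence q refines p, and as p has the maximal number s ≥ s′ of clusters, p and q coincide.
--
-- Equality in an arbitrary field is undecidable, so the case distinctions (zero tests, counting
-- factors up to scalars) run in the double-negation monad; this is harmless since everything
-- concluded from them is a decidable statement about ℕ.

open import Defs
open import Level using (Level)
open import Data.Nat using (ℕ; _≤_)
open import Data.Fin using (Fin)
open import Data.Rational as ℚ using (ℚ)
open import Relation.Nullary using (¬_)

open import Level using (_⊔_)
open import Data.Nat as ℕ using (zero; suc; _<_; z≤n; s≤s)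
import Data.Nat.Properties as ℕ
import Data.Nat.Coprimality as Coprime
import Data.Integer as ℤ
import Data.Integer.Properties as ℤ
import Data.Rational.Properties as ℚ
open import Data.Fin as Fin using (zero; suc; punchIn)
import Data.Fin.Properties as Fin
open import Data.Bool using (Bool; true; false; _∨_; if_then_else_)
open import Data.Product using (∃; ∃₂; _×_; _,_; proj₁; proj₂)
open import Data.Sum as Sum using (_⊎_; inj₁; inj₂)
open import Data.Empty using (⊥; ⊥-elim)
open import Data.List using (List; []; _∷_; _++_; length; lookup)
open import Data.List.Relation.Unary.All as All using (All; []; _∷_)
open import Data.List.Relation.Unary.Any as Any using (Any; here; there)
import Data.List.Relation.Unary.Any.Properties as Any
open import Data.List.Relation.Binary.Permutation.Propositional as ↭ using (_↭_)
open import Data.List.Relation.Binary.Pointwise using (Pointwise; []; _∷_)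
open import Data.List.Membership.Propositional using (_∈_)
open import Data.List.Membership.Propositional.Properties using (∈-lookup)
open import Data.Vec.Functional as Vector using (Vector; insertAt)
open import Data.Vec.Functional.Properties using (insertAt-lookup; insertAt-punchIn; lookup-++ˡ; lookup-++ʳ)
open import Function using (_∘_; _∘′_; _⇔_; mk⇔)
open import Relation.Nullary using (yes; no; does)
open import Relation.Nullary.Decidable using (¬¬-excluded-middle; decidable-stable; dec-true; from-yes)
open import Relation.Nullary.Negation using (¬¬-map)
open import Relation.Binary using (Rel; IsEquivalence)
open import Relation.Binary.PropositionalEquality as ≡ using (_≡_; _≢_)

infixl 1 _>>=_

_>>=_ : ∀ {a b} {A : Set a} {B : Set b} → ¬ ¬ A → (A → ¬ ¬ B) → ¬ ¬ B
(m >>= f) ¬b = m (λ a → f a ¬b)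

pure : ∀ {a} {A : Set a} → A → ¬ ¬ A
pure a ¬a = ¬a a

¬¬-Π : ∀ {p} {n} {P : Fin n → Set p} → (∀ i → ¬ ¬ P i) → ¬ ¬ (∀ i → P i)
¬¬-Π {n = zero}  h = pure λ ()
¬¬-Π {n = suc n} h = do
  p₀ ← h zero
  p₊ ← ¬¬-Π (h ∘ suc)
  pure λ where zero → p₀ ; (suc i) → p₊ i

¬∀⇒¬¬∃¬ : ∀ {p} {n} {P : Fin n → Set p} → ¬ (∀ i → P i) → ¬ ¬ ∃ λ i → ¬ P i
¬∀⇒¬¬∃¬ ¬∀ ¬∃ = ¬¬-Π (λ i ¬Pi → ¬∃ (i , ¬Pi)) ¬∀

¬[≡true→A]⇒≡true×¬A : ∀ {a} {A : Set a} (β : Bool) → ¬ (β ≡ true → A) → β ≡ true × ¬ A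
¬[≡true→A]⇒≡true×¬A true  ¬[T→A] = ≡.refl , λ a → ¬[T→A] (λ _ → a)
¬[≡true→A]⇒≡true×¬A false ¬[T→A] = ⊥-elim (¬[T→A] λ ())

module LinearAlgebra {c ℓ : Level} (F : Field c ℓ) where
  open Field F hiding (zero)
  open import Algebra.Properties.Semiring.Sum semiring
    using (sum; sum-syntax; ∑-comm; ∑-distrib-+; *-distribˡ-sum; *-distribʳ-sum; sum-cong-≋; sum-replicate-zero; sum-remove)
  open import Relation.Binary.Reasoning.Setoid setoid
  open import Algebra.Properties.Ring ring using (-‿distribˡ-*; -‿distribʳ-*)

  lincombᶠ : ∀ {d m} → Vector Carrier d → (Fin d → Vector Carrier m) → Vector Carrier m
  lincombᶠ {d} cs w j = ∑[ a < d ] (cs a * w a j)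

  InSpanᶠ : ∀ {d m} → Vector Carrier m → (Fin d → Vector Carrier m) → Set (c ⊔ ℓ)
  InSpanᶠ v w = ∃ λ cs → ∀ j → v j ≈ lincombᶠ cs w j

  LinIndepᶠ : ∀ {d m} → (Fin d → Vector Carrier m) → Set (c ⊔ ℓ)
  LinIndepᶠ w = ∀ cs → (∀ j → lincombᶠ cs w j ≈ 0#) → ∀ a → cs a ≈ 0#

  sum-zero : ∀ {d} {f : Vector Carrier d} → (∀ a → f a ≈ 0#) → sum f ≈ 0#
  sum-zero {d} f≈0 = trans (sum-cong-≋ f≈0) (sum-replicate-zero d)

  lincombᶠ-assoc : ∀ {d e m} (cs : Vector Carrier d) (y : Fin d → Vector Carrier m)
    (D : Fin d → Vector Carrier e) (z : Fin e → Vector Carrier m) →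
    (∀ u j → y u j ≈ lincombᶠ (D u) z j) →
    ∀ j → lincombᶠ cs y j ≈ lincombᶠ (lincombᶠ cs D) z j
  lincombᶠ-assoc {d} {e} cs y D z y≈Dz j = begin
    ∑[ u < d ] (cs u * y u j)                            ≈⟨ sum-cong-≋ (λ u → *-congˡ (y≈Dz u j)) ⟩
    ∑[ u < d ] (cs u * ∑[ v < e ] (D u v * z v j))       ≈⟨ sum-cong-≋ (λ u → *-distribˡ-sum (cs u) (λ v → D u v * z v j)) ⟩
    ∑[ u < d ] ∑[ v < e ] (cs u * (D u v * z v j))       ≈⟨ ∑-comm (λ u v → cs u * (D u v * z v j)) ⟩
    ∑[ v < e ] ∑[ u < d ] (cs u * (D u v * z v j))       ≈⟨ sum-cong-≋ (λ v → sum-cong-≋ (λ u → sym (*-assoc (cs u) (D u v) (z v j)))) ⟩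
    ∑[ v < e ] ∑[ u < d ] (cs u * D u v * z v j)         ≈⟨ sum-cong-≋ (λ v → *-distribʳ-sum (z v j) (λ u → cs u * D u v)) ⟨
    ∑[ v < e ] (∑[ u < d ] (cs u * D u v) * z v j)       ∎

  InSpanᶠ-trans : ∀ {d e m} {v : Vector Carrier m} {y : Fin d → Vector Carrier m} {z : Fin e → Vector Carrier m} →
    InSpanᶠ v y → (∀ u → InSpanᶠ (y u) z) → InSpanᶠ v z
  InSpanᶠ-trans {y = y} {z} (cs , v≈) y⊆z =
    lincombᶠ cs (proj₁ ∘ y⊆z) , λ j → trans (v≈ j) (lincombᶠ-assoc cs y (proj₁ ∘ y⊆z) z (proj₂ ∘ y⊆z) j)

  InSpanᶠ-scale : ∀ {d m} {u v : Vector Carrier m} {w : Fin d → Vector Carrier m} s →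
    (∀ j → u j ≈ s * v j) → InSpanᶠ v w → InSpanᶠ u w
  InSpanᶠ-scale {d} {u = u} {v} {w} s u≈sv (cs , v≈) = (λ a → s * cs a) , λ j → begin
    u j                                ≈⟨ u≈sv j ⟩
    s * v j                            ≈⟨ *-congˡ (v≈ j) ⟩
    s * ∑[ a < d ] (cs a * w a j)      ≈⟨ *-distribˡ-sum s (λ a → cs a * w a j) ⟩
    ∑[ a < d ] (s * (cs a * w a j))    ≈⟨ sum-cong-≋ (λ a → sym (*-assoc s (cs a) (w a j))) ⟩
    ∑[ a < d ] (s * cs a * w a j)      ∎

  InSpanᶠ-member : ∀ {d m} (w : Fin d → Vector Carrier m) i → InSpanᶠ (w i) w
  InSpanᶠ-member {suc d} w i = δ , λ j → sym (begin
    ∑[ a < suc d ] (δ a * w a j)                                ≈⟨ sum-remove {i = i} (λ a → δ a * w a j) ⟩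
    δ i * w i j + ∑[ e < d ] (δ (punchIn i e) * w (punchIn i e) j)
      ≈⟨ +-cong (*-congʳ (reflexive (insertAt-lookup _ i 1#)))
                (sum-zero (λ e → trans (*-congʳ (reflexive (insertAt-punchIn _ i 1# e))) (zeroˡ _))) ⟩
    1# * w i j + 0#                                          ≈⟨ +-identityʳ _ ⟩
    1# * w i j                                               ≈⟨ *-identityˡ _ ⟩
    w i j                                                    ∎)
    where δ = insertAt (λ _ → 0#) i 1#

  LinIndepᶠ-dropColumn : ∀ {d m} {w : Fin d → Vector Carrier (suc m)} →
    (∀ a → w a zero ≈ 0#) → LinIndepᶠ w → LinIndepᶠ (λ a t → w a (suc t))
  LinIndepᶠ-dropColumn w₀≈0 indep cs cs·w₊≈0 = indep cs λ where
    zero    → sum-zero (λ a → trans (*-congˡ (w₀≈0 a)) (zeroʳ (cs a)))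
    (suc t) → cs·w₊≈0 t

  -- One step of Gaussian elimination: clear column 0 with the pivot row a₀ (y inverts the
  -- pivot), delete row a₀ and column 0.
  eliminate : ∀ {d m} → (Fin (suc d) → Vector Carrier (suc m)) → Fin (suc d) → Carrier →
    Fin d → Vector Carrier m
  eliminate w a₀ y e t = w (punchIn a₀ e) (suc t) + w (punchIn a₀ e) zero * - (y * w a₀ (suc t))

  LinIndepᶠ-eliminate : ∀ {d m} {w : Fin (suc d) → Vector Carrier (suc m)} {a₀ y} →
    w a₀ zero * y ≈ 1# → LinIndepᶠ w → LinIndepᶠ (eliminate w a₀ y)
  -- A dependency cs′ of the reduced rows lifts to the dependency insertAt cs′ a₀ c₀ of w.
  LinIndepᶠ-eliminate {d} {m} {w} {a₀} {y} pivot indep cs′ cs′·N≈0 e = begin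
    cs′ e              ≡⟨ insertAt-punchIn cs′ a₀ c₀ e ⟨
    cs (punchIn a₀ e)  ≈⟨ indep cs cs·w≈0 (punchIn a₀ e) ⟩
    0#                 ∎
    where
    V : Vector Carrier (suc m)
    V = lincombᶠ cs′ (w ∘ punchIn a₀)
    c₀ : Carrier
    c₀ = - (V zero * y)
    cs : Vector Carrier (suc d)
    cs = insertAt cs′ a₀ c₀

    cs·w≈ : ∀ j → lincombᶠ cs w j ≈ c₀ * w a₀ j + V j
    cs·w≈ j = trans (sum-remove {i = a₀} (λ a → cs a * w a j))
      (+-cong (*-congʳ (reflexive (insertAt-lookup cs′ a₀ c₀)))
              (sum-cong-≋ (λ e → *-congʳ (reflexive (insertAt-punchIn cs′ a₀ c₀ e)))))

    cs′·N≈ : ∀ t → lincombᶠ cs′ (eliminate w a₀ y) t ≈ V (suc t) + V zero * - (y * w a₀ (suc t))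
    cs′·N≈ t = begin
      ∑[ e < d ] (cs′ e * (A e + B e * k))                 ≈⟨ sum-cong-≋ (λ e → trans (distribˡ (cs′ e) _ _) (+-congˡ (sym (*-assoc _ _ _)))) ⟩
      ∑[ e < d ] (cs′ e * A e + cs′ e * B e * k)           ≈⟨ ∑-distrib-+ (λ e → cs′ e * A e) (λ e → cs′ e * B e * k) ⟩
      V (suc t) + ∑[ e < d ] (cs′ e * B e * k)             ≈⟨ +-congˡ (*-distribʳ-sum k (λ e → cs′ e * B e)) ⟨
      V (suc t) + V zero * k                               ∎
      where
      A B : Vector Carrier d
      A e = w (punchIn a₀ e) (suc t)
      B e = w (punchIn a₀ e) zero
      k : Carrier
      k = - (y * w a₀ (suc t))

    cs·w≈0 : ∀ j → lincombᶠ cs w j ≈ 0#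
    cs·w≈0 zero = begin
      lincombᶠ cs w zero                     ≈⟨ cs·w≈ zero ⟩
      - (V zero * y) * w a₀ zero + V zero    ≈⟨ +-congʳ (-‿distribˡ-* _ _) ⟨
      - (V zero * y * w a₀ zero) + V zero    ≈⟨ +-congʳ (-‿cong (*-assoc _ _ _)) ⟩
      - (V zero * (y * w a₀ zero)) + V zero  ≈⟨ +-congʳ (-‿cong (*-congˡ (trans (*-comm _ _) pivot))) ⟩
      - (V zero * 1#) + V zero               ≈⟨ +-congʳ (-‿cong (*-identityʳ _)) ⟩
      - V zero + V zero                      ≈⟨ -‿inverseˡ _ ⟩
      0#                                     ∎
    cs·w≈0 (suc t) = begin
      lincombᶠ cs w (suc t)                          ≈⟨ cs·w≈ (suc t) ⟩
      - (V zero * y) * w a₀ (suc t) + V (suc t)      ≈⟨ +-comm _ _ ⟩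
      V (suc t) + - (V zero * y) * w a₀ (suc t)      ≈⟨ +-congˡ (-‿distribˡ-* _ _) ⟨
      V (suc t) + - (V zero * y * w a₀ (suc t))      ≈⟨ +-congˡ (-‿cong (*-assoc _ _ _)) ⟩
      V (suc t) + - (V zero * (y * w a₀ (suc t)))    ≈⟨ +-congˡ (-‿distribʳ-* _ _) ⟩
      V (suc t) + V zero * - (y * w a₀ (suc t))      ≈⟨ cs′·N≈ t ⟨
      lincombᶠ cs′ (eliminate w a₀ y) t              ≈⟨ cs′·N≈0 t ⟩
      0#                                             ∎

  ¬LinIndepᶠ-of-length> : ∀ {d m} → m < d → (w : Fin d → Vector Carrier m) → ¬ LinIndepᶠ w
  ¬LinIndepᶠ-of-length> {m = zero} (s≤s _) w indep = 1#≉0# (indep (λ _ → 1#) (λ ()) zero)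
  ¬LinIndepᶠ-of-length> {m = suc m} (s≤s m<d) w indep = ¬¬-excluded-middle λ where
    (yes column₀≈0) →
      ¬LinIndepᶠ-of-length> (ℕ.m<n⇒m<1+n m<d) (λ a t → w a (suc t))
        (LinIndepᶠ-dropColumn {w = w} column₀≈0 indep)
    (no column₀≉0) → ¬∀⇒¬¬∃¬ column₀≉0 λ (a₀ , pivot≉0) →
      let (y , pivot) = inverse (w a₀ zero) pivot≉0
      in ¬LinIndepᶠ-of-length> m<d (eliminate w a₀ y) (LinIndepᶠ-eliminate {w = w} pivot indep)

  LinIndepᶠ⇒≤ : ∀ {d m} (w : Fin d → Vector Carrier m) → LinIndepᶠ w → d ≤ m
  LinIndepᶠ⇒≤ w indep = decidable-stable (_ ℕ.≤? _) λ d≰m →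
    ¬LinIndepᶠ-of-length> (ℕ.≰⇒> d≰m) w indep

  -- Steinitz: the coordinates of b with respect to w form an independent family in Fᵉ.
  LinIndepᶠ-InSpanᶠ⇒≤ : ∀ {d e m} (b : Fin d → Vector Carrier m) (w : Fin e → Vector Carrier m) →
    LinIndepᶠ b → (∀ a → InSpanᶠ (b a) w) → d ≤ e
  LinIndepᶠ-InSpanᶠ⇒≤ b w indep b⊆w = LinIndepᶠ⇒≤ (proj₁ ∘ b⊆w) λ cs cs·D≈0 → indep cs λ j → begin
    lincombᶠ cs b j                          ≈⟨ lincombᶠ-assoc cs b (proj₁ ∘ b⊆w) w (proj₂ ∘ b⊆w) j ⟩
    lincombᶠ (lincombᶠ cs (proj₁ ∘ b⊆w)) w j ≈⟨ sum-zero (λ v → trans (*-congʳ (cs·D≈0 v)) (zeroˡ _)) ⟩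
    0#                                       ∎

module Multiplicity {a r} {A : Set a} {_∼_ : Rel A r} (∼-isEquivalence : IsEquivalence _∼_) where
  open IsEquivalence ∼-isEquivalence renaming (sym to ∼-sym; trans to ∼-trans)

  data Count (x : A) : List A → ℕ → Set (a ⊔ r) where
    []   : Count x [] 0
    hit  : ∀ {y L k} → x ∼ y → Count x L k → Count x (y ∷ L) (suc k)
    miss : ∀ {y L k} → ¬ x ∼ y → Count x L k → Count x (y ∷ L) k

  Count-unique : ∀ {x L k k′} → Count x L k → Count x L k′ → k ≡ k′
  Count-unique []          []           = ≡.refl
  Count-unique (hit _ p)   (hit _ q)    = ≡.cong suc (Count-unique p q)
  Count-unique (hit x∼y _) (miss x≁y _) = ⊥-elim (x≁y x∼y)
  Count-unique (miss x≁y _) (hit x∼y _) = ⊥-elim (x≁y x∼y)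
  Count-unique (miss _ p)  (miss _ q)   = Count-unique p q

  Count-exists : ∀ x L → ¬ ¬ ∃ (Count x L)
  Count-exists x []      = pure (0 , [])
  Count-exists x (y ∷ L) = do
    (k , #L) ← Count-exists x L
    ¬¬-excluded-middle >>= λ where
      (yes x∼y) → pure (suc k , hit x∼y #L)
      (no x≁y)  → pure (k , miss x≁y #L)

  Count-++⁻ : ∀ {x} L₁ {L₂ k} → Count x (L₁ ++ L₂) k →
    ∃₂ λ k₁ k₂ → Count x L₁ k₁ × Count x L₂ k₂ × k ≡ k₁ ℕ.+ k₂
  Count-++⁻ []       #L₂ = 0 , _ , [] , #L₂ , ≡.refl
  Count-++⁻ (y ∷ L₁) (hit x∼y #L) with Count-++⁻ L₁ #L
  ... | k₁ , k₂ , #L₁ , #L₂ , k≡ = suc k₁ , k₂ , hit x∼y #L₁ , #L₂ , ≡.cong suc k≡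
  Count-++⁻ (y ∷ L₁) (miss x≁y #L) with Count-++⁻ L₁ #L
  ... | k₁ , k₂ , #L₁ , #L₂ , k≡ = k₁ , k₂ , miss x≁y #L₁ , #L₂ , k≡

  Count-↭ : ∀ {x L₁ L₂ k} → L₁ ↭ L₂ → Count x L₁ k → Count x L₂ k
  Count-↭ ↭.refl        #L = #L
  Count-↭ (↭.prep y p)  (hit x∼y #L)  = hit x∼y (Count-↭ p #L)
  Count-↭ (↭.prep y p)  (miss x≁y #L) = miss x≁y (Count-↭ p #L)
  Count-↭ (↭.swap y z p) (hit u (hit v #L))   = hit v (hit u (Count-↭ p #L))
  Count-↭ (↭.swap y z p) (hit u (miss v #L))  = miss v (hit u (Count-↭ p #L))
  Count-↭ (↭.swap y z p) (miss u (hit v #L))  = hit v (miss u (Count-↭ p #L))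
  Count-↭ (↭.swap y z p) (miss u (miss v #L)) = miss v (miss u (Count-↭ p #L))
  Count-↭ (↭.trans p q) #L = Count-↭ q (Count-↭ p #L)

  Count-Pointwise : ∀ {x L₁ L₂ k} → Pointwise _∼_ L₁ L₂ → Count x L₁ k → Count x L₂ k
  Count-Pointwise []          []            = []
  Count-Pointwise (y∼z ∷ eqs) (hit x∼y #L)  = hit (∼-trans x∼y y∼z) (Count-Pointwise eqs #L)
  Count-Pointwise (y∼z ∷ eqs) (miss x≁y #L) =
    miss (λ x∼z → x≁y (∼-trans x∼z (∼-sym y∼z))) (Count-Pointwise eqs #L)

  Count-¬Any⇒0 : ∀ {x L k} → ¬ Any (x ∼_) L → Count x L k → k ≡ 0
  Count-¬Any⇒0 x∉L []            = ≡.refl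
  Count-¬Any⇒0 x∉L (hit x∼y _)   = ⊥-elim (x∉L (here x∼y))
  Count-¬Any⇒0 x∉L (miss _ #L)   = Count-¬Any⇒0 (x∉L ∘′ there) #L

  Count-Any⇒>0 : ∀ {x L k} → Any (x ∼_) L → Count x L k → 0 < k
  Count-Any⇒>0 _         (hit _ _)     = s≤s z≤n
  Count-Any⇒>0 (here x∼y) (miss x≁y _) = ⊥-elim (x≁y x∼y)
  Count-Any⇒>0 (there x∈L) (miss _ #L) = Count-Any⇒>0 x∈L #L

ℕtoℚ≡mkℚ : ∀ m → ℕtoℚ m ≡ ℚ.mkℚ (ℤ.+ m) 0 (Coprime.sym (Coprime.1-coprimeTo m))
ℕtoℚ≡mkℚ m = ℚ.normalize-coprime (Coprime.sym (Coprime.1-coprimeTo m))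

ℕtoℚ-nonNeg : ∀ m → ℚ.NonNegative (ℕtoℚ m)
ℕtoℚ-nonNeg m rewrite ℕtoℚ≡mkℚ m = _

ℕtoℚ-cancel-≤ : ∀ {m n} → ℕtoℚ m ℚ.≤ ℕtoℚ n → m ≤ n
ℕtoℚ-cancel-≤ {m} {n} m≤n rewrite ℕtoℚ≡mkℚ m | ℕtoℚ≡mkℚ n =
  ℤ.drop‿+≤+ (≡.subst₂ ℤ._≤_ (ℤ.*-identityʳ (ℤ.+ m)) (ℤ.*-identityʳ (ℤ.+ n)) (ℚ.drop-*≤* m≤n))

ℕtoℚ-homo-* : ∀ m n → ℕtoℚ m ℚ.* ℕtoℚ n ≡ ℕtoℚ (m ℕ.* n)
ℕtoℚ-homo-* m n rewrite ℕtoℚ≡mkℚ m | ℕtoℚ≡mkℚ n = ≡.cong (ℚ._/ 1) (ℤ.+◃n≡+n (m ℕ.* n))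

scaled-≤⇒*-≤ : ∀ a {τ} r d → ℕtoℚ a ℚ.≤ τ → τ ℚ.* ℕtoℚ r ℚ.≤ ℕtoℚ d → a ℕ.* r ≤ d
scaled-≤⇒*-≤ a {τ} r d a≤τ τr≤d = ℕtoℚ-cancel-≤ (ℚ.≤-trans
  (≡.subst (ℚ._≤ τ ℚ.* ℕtoℚ r) (ℕtoℚ-homo-* a r) (ℚ.*-monoʳ-≤-nonNeg (ℕtoℚ r) {{ℕtoℚ-nonNeg r}} a≤τ))
  τr≤d)

surjective∧≤⇒injective : ∀ {m m′} (f : Fin m → Fin m′) → (∀ i → ∃ λ u → f u ≡ i) → m ≤ m′ →
  ∀ x y → f x ≡ f y → x ≡ y
surjective∧≤⇒injective {ℕ.suc m} {m′} f f-surj m≤m′ x y fx≡fy with x Fin.≟ y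
... | yes x≡y = x≡y
... | no x≢y = ⊥-elim (ℕ.≤⇒≯ (Fin.injective⇒≤ {f = h} h-injective) m≤m′)
  where
  -- g is a section of f; the value fx is hit twice, so deleting one preimage of it that g
  -- avoids leaves an injection Fin m′ → Fin m.
  g : Fin m′ → Fin (ℕ.suc m)
  g i = proj₁ (f-surj i)
  fg : ∀ i → f (g i) ≡ i
  fg i = proj₂ (f-surj i)
  z : Fin (ℕ.suc m)
  z with x Fin.≟ g (f x)
  ... | yes _ = y
  ... | no _  = x
  z≢gfx : z ≢ g (f x)
  z≢gfx with x Fin.≟ g (f x)
  ... | yes x≡gfx = λ y≡gfx → x≢y (≡.trans x≡gfx (≡.sym y≡gfx))
  ... | no x≢gfx  = x≢gfx
  fz≡fx : f z ≡ f x
  fz≡fx with x Fin.≟ g (f x)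
  ... | yes _ = ≡.sym fx≡fy
  ... | no _  = ≡.refl
  z≢g : ∀ u → z ≢ g u
  z≢g u z≡gu = z≢gfx (≡.trans z≡gu (≡.cong g (≡.trans (≡.sym (fg u)) (≡.trans (≡.cong f (≡.sym z≡gu)) fz≡fx))))
  h : Fin m′ → Fin m
  h u = Fin.punchOut (z≢g u)
  h-injective : ∀ {u v} → h u ≡ h v → u ≡ v
  h-injective {u} {v} hu≡hv =
    ≡.trans (≡.sym (fg u)) (≡.trans (≡.cong f (Fin.punchOut-injective (z≢g u) (z≢g v) hu≡hv)) (fg v))

refines∧≤⇒same-blocks : ∀ {k s s′} (p : Fin k → Fin s) (q : Fin k → Fin s′) →
  (∀ i → ∃ λ a → p a ≡ i) → (∀ i → ∃ λ a → q a ≡ i) →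
  (∀ a b → q a ≡ q b → p a ≡ p b) → s′ ≤ s →
  ∀ a b → (p a ≡ p b) ⇔ (q a ≡ q b)
refines∧≤⇒same-blocks p q p-surj q-surj q⊑p s′≤s a b =
  mk⇔ (λ pa≡pb → f-injective (q a) (q b) (≡.trans (f∘q≡p a) (≡.trans pa≡pb (≡.sym (f∘q≡p b))))) (q⊑p a b)
  where
  f : Fin _ → Fin _
  f u = p (proj₁ (q-surj u))
  f∘q≡p : ∀ a → f (q a) ≡ p a
  f∘q≡p a = q⊑p _ a (proj₂ (q-surj (q a)))
  f-surjective : ∀ i → ∃ λ u → f u ≡ i
  f-surjective i = let (a , pa≡i) = p-surj i in q a , ≡.trans (f∘q≡p a) pa≡i
  f-injective = surjective∧≤⇒injective f f-surjective s′≤s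

∨≡true⇒ : ∀ (x y : Bool) → x ∨ y ≡ true → x ≡ true ⊎ y ≡ true
∨≡true⇒ true  _ _   = inj₁ ≡.refl
∨≡true⇒ false _ y≡t = inj₂ y≡t

module _ {c ℓ : Level} (F : Field c ℓ) (n : ℕ) where
  open Field F hiding (zero)
  open Circuits F n
  open LinearAlgebra F
  open import Algebra.Properties.Semiring.Sum semiring using (sum)
  import Relation.Binary.Reasoning.Setoid setoid as ≈-Reasoning

  sumF≡sum : ∀ {d} (f : Vector Carrier d) → sumF f ≡ sum f
  sumF≡sum {zero}  f = ≡.refl
  sumF≡sum {suc d} f = ≡.cong (f zero +_) (sumF≡sum (f ∘ suc))

  InSpan⇒InSpanᶠ : ∀ {v L} → InSpan v L → InSpanᶠ v (lookup L)
  InSpan⇒InSpanᶠ {L = L} (cs , v≈) = cs , λ t → trans (v≈ t) (reflexive (sumF≡sum (λ a → cs a * lookup L a t)))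

  LinIndep⇒LinIndepᶠ : ∀ {B} → LinIndep B → LinIndepᶠ (lookup B)
  LinIndep⇒LinIndepᶠ {B} indep cs cs·B≈0 =
    indep cs λ t → trans (reflexive (sumF≡sum (λ a → cs a * lookup B a t))) (cs·B≈0 t)

  InSpanᶠ-++ˡ : ∀ {d e} {v : Affine} (w₁ : Fin d → Affine) (w₂ : Fin e → Affine) →
    InSpanᶠ v w₁ → InSpanᶠ v (w₁ Vector.++ w₂)
  InSpanᶠ-++ˡ w₁ w₂ v∈w₁ = InSpanᶠ-trans v∈w₁ λ a →
    ≡.subst (λ u → InSpanᶠ u (w₁ Vector.++ w₂)) (lookup-++ˡ w₁ w₂ a) (InSpanᶠ-member _ _)

  InSpanᶠ-++ʳ : ∀ {d e} {v : Affine} (w₁ : Fin d → Affine) (w₂ : Fin e → Affine) →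
    InSpanᶠ v w₂ → InSpanᶠ v (w₁ Vector.++ w₂)
  InSpanᶠ-++ʳ w₁ w₂ v∈w₂ = InSpanᶠ-trans v∈w₂ λ a →
    ≡.subst (λ u → InSpanᶠ u (w₁ Vector.++ w₂)) (lookup-++ʳ w₁ w₂ a) (InSpanᶠ-member _ _)

  x≉0∧y≉0⇒x*y≉0 : ∀ {s t} → ¬ s ≈ 0# → ¬ t ≈ 0# → ¬ s * t ≈ 0#
  x≉0∧y≉0⇒x*y≉0 {s} {t} s≉0 t≉0 st≈0 = t≉0 (begin
    t               ≈⟨ *-identityˡ t ⟨
    1# * t          ≈⟨ *-congʳ (trans (*-comm _ _) s*s⁻¹≈1) ⟨
    s⁻¹ * s * t     ≈⟨ *-assoc _ _ _ ⟩
    s⁻¹ * (s * t)   ≈⟨ *-congˡ st≈0 ⟩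
    s⁻¹ * 0#        ≈⟨ zeroʳ _ ⟩
    0#              ∎)
    where
    open ≈-Reasoning
    s⁻¹ = proj₁ (inverse s s≉0)
    s*s⁻¹≈1 = proj₂ (inverse s s≉0)

  Assoc-isEquivalence : IsEquivalence Assoc
  Assoc-isEquivalence = record
    { refl  = 1# , 1#≉0# , λ t → sym (*-identityˡ _)
    ; sym   = Assoc-sym
    ; trans = λ (s , s≉0 , x≈sy) (s′ , s′≉0 , y≈s′z) → s * s′ , x≉0∧y≉0⇒x*y≉0 s≉0 s′≉0 ,
                λ t → trans (x≈sy t) (trans (*-congˡ (y≈s′z t)) (sym (*-assoc _ _ _)))
    }
    where
    Assoc-sym : ∀ {x y} → Assoc x y → Assoc y x
    Assoc-sym {x} {y} (s , s≉0 , x≈sy) = s⁻¹ , s⁻¹≉0 , λ t → begin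
      y t               ≈⟨ *-identityˡ _ ⟨
      1# * y t          ≈⟨ *-congʳ (trans (*-comm _ _) s*s⁻¹≈1) ⟨
      s⁻¹ * s * y t     ≈⟨ *-assoc _ _ _ ⟩
      s⁻¹ * (s * y t)   ≈⟨ *-congˡ (x≈sy t) ⟨
      s⁻¹ * x t         ∎
      where
      open ≈-Reasoning
      s⁻¹ = proj₁ (inverse s s≉0)
      s*s⁻¹≈1 = proj₂ (inverse s s≉0)
      s⁻¹≉0 : ¬ s⁻¹ ≈ 0#
      s⁻¹≉0 s⁻¹≈0 = 1#≉0# (trans (sym s*s⁻¹≈1) (trans (*-congˡ s⁻¹≈0) (zeroʳ s)))

  open Multiplicity Assoc-isEquivalence

  Assoc-InSpanᶠ : ∀ {d} {x y} {w : Fin d → Affine} → Assoc x y → InSpanᶠ y w → InSpanᶠ x w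
  Assoc-InSpanᶠ (s , _ , x≈sy) = InSpanᶠ-scale s x≈sy

  NonConst-≁-const : ∀ {x K} → NonConst x → All IsConst K → ¬ Any (Assoc x) K
  NonConst-≁-const x≉const (y-const ∷ _) (here (s , _ , x≈sy)) =
    x≉const λ i → trans (x≈sy (suc i)) (trans (*-congˡ (y-const i)) (zeroʳ s))
  NonConst-≁-const x≉const (_ ∷ K-const) (there x∈K) = NonConst-≁-const x≉const K-const x∈K

  Count-≈ₘ : ∀ {x L₁ L₂ k} → L₁ ≈ₘ L₂ → Count x L₁ k → Count x L₂ k
  Count-≈ₘ (_ , L₁↭L , L≈L₂) = Count-Pointwise L≈L₂ ∘ Count-↭ L₁↭L

  collect-Any⁺ : ∀ {p} {P : Affine → Set p} {k} (S : Selector k) (R : Fin k → List Affine) {g} →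
    S g ≡ true → Any P (R g) → Any P (collect S R)
  collect-Any⁺ {k = suc k} S R {zero} Sg P∈Rg rewrite Sg = Any.++⁺ˡ P∈Rg
  collect-Any⁺ {k = suc k} S R {suc g} Sg P∈Rg =
    Any.++⁺ʳ (if S zero then R zero else []) (collect-Any⁺ (S ∘ suc) (R ∘ suc) Sg P∈Rg)

  collect-∈⁻ : ∀ {k} (S : Selector k) (R : Fin k → List Affine) {x} → x ∈ collect S R →
    ∃ λ g → S g ≡ true × x ∈ R g
  collect-∈⁻ {suc k} S R x∈ with Any.++⁻ (if S zero then R zero else []) x∈
  ... | inj₂ x∈rest with collect-∈⁻ (S ∘ suc) (R ∘ suc) x∈rest
  ...   | g , Sg , x∈Rg = suc g , Sg , x∈Rg
  collect-∈⁻ {suc k} S R x∈ | inj₁ x∈R₀ with S zero in S₀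
  ...   | true = zero , S₀ , x∈R₀

  module _ {k} {C : Circuit k} {S : Selector k} {G : List Affine} {R : Fin k → List Affine}
    (dec : IsGcdDecomposition C S G R) {x : Affine} (x≉const : NonConst x)
    {g : Fin k} (Sg : S g ≡ true) {cg gS : ℕ} (#C : Count x (C g) cg) (#G : Count x G gS)
    where

    gcd-count-split : ∃ λ r → Count x (R g) r × cg ≡ gS ℕ.+ r
    gcd-count-split with (K , K-const , C≈ₘ) ← proj₁ (proj₂ (proj₂ dec)) g Sg
                    with (gS′ , rest , #G′ , #rest , cg≡) ← Count-++⁻ G (Count-≈ₘ C≈ₘ #C)
                    with (r , κ , #R , #K , rest≡) ← Count-++⁻ (R g) #rest
      = r , #R , (begin
        cg               ≡⟨ cg≡ ⟩
        gS′ ℕ.+ rest     ≡⟨ ≡.cong₂ ℕ._+_ (Count-unique #G′ #G) rest≡ ⟩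
        gS ℕ.+ (r ℕ.+ κ) ≡⟨ ≡.cong (λ κ → gS ℕ.+ (r ℕ.+ κ)) (Count-¬Any⇒0 (NonConst-≁-const x≉const K-const) #K) ⟩
        gS ℕ.+ (r ℕ.+ 0) ≡⟨ ≡.cong (gS ℕ.+_) (ℕ.+-identityʳ r) ⟩
        gS ℕ.+ r         ∎)
      where open ≡.≡-Reasoning

    gcd-count-≤ : gS ≤ cg
    gcd-count-≤ with (r , _ , cg≡) ← gcd-count-split = ≡.subst (gS ≤_) (≡.sym cg≡) (ℕ.m≤m+n gS r)

    gcd-count-≡ : ¬ Any (Assoc x) (R g) → cg ≡ gS
    gcd-count-≡ x∉Rg with (r , #R , cg≡) ← gcd-count-split =
      ≡.trans cg≡ (≡.trans (≡.cong (gS ℕ.+_) (Count-¬Any⇒0 x∉Rg #R)) (ℕ.+-identityʳ gS))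

    gcd-count-< : Any (Assoc x) (R g) → gS < cg
    gcd-count-< x∈Rg with (r , #R , cg≡) ← gcd-count-split =
      ≡.subst (gS <_) (≡.sym cg≡) (ℕ.m<m+n gS (Count-Any⇒>0 x∈Rg #R))

  merged-factor-∈-parts : ∀ {k} {C : Circuit k} {Si Sj SQ SP : Selector k} {Gi Gj GQ GP : List Affine}
    {Ri Rj RQ RP : Fin k → List Affine} →
    IsGcdDecomposition C Si Gi Ri → IsGcdDecomposition C Sj Gj Rj →
    IsGcdDecomposition C SQ GQ RQ → IsGcdDecomposition C SP GP RP →
    (∀ g → SP g ≡ true → Si g ≡ true ⊎ Sj g ≡ true) →
    ∀ {a b} → Si a ≡ true → SQ a ≡ true → Sj b ≡ true → SQ b ≡ true →
    ∀ {m x} → SP m ≡ true → Si m ≡ true → x ∈ RP m →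
    ¬ ¬ (Any (Assoc x) (Ri m) ⊎ Any (Assoc x) (RQ a) ⊎ Any (Assoc x) (Rj b))
  merged-factor-∈-parts {C = C} {SP = SP} {Gi} {Gj} {GQ} {GP} {Ri} {Rj} {RQ} {RP}
    dec-i dec-j dec-Q dec-P P⊆i∪j {a} {b} ia Qa jb Qb {m} {x} Pm im x∈RPm none =
    some-gate-lacks-x λ (g , Pg , x∉RPg) →
    Count-exists x (C m) λ (cm , #m) → Count-exists x (C a) λ (ca , #a) →
    Count-exists x (C b) λ (cb , #b) → Count-exists x (C g) λ (cg , #g) →
    Count-exists x Gi λ (gi , #i) → Count-exists x Gj λ (gj , #j) →
    Count-exists x GQ λ (gQ , #Q) → Count-exists x GP λ (gP , #P) →
    ℕ.<-irrefl ≡.refl (begin-strict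
      cm  ≡⟨ gcd-count-≡ dec-i x≉const im #m #i (none ∘ inj₁) ⟩
      gi  ≤⟨ gi≤cg Pg #a #b #g #i #j #Q ⟩
      cg  ≡⟨ gcd-count-≡ dec-P x≉const Pg #g #P x∉RPg ⟩
      gP  <⟨ gcd-count-< dec-P x≉const Pm #m #P x∼RPm ⟩
      cm  ∎)
    where
    open ℕ.≤-Reasoning

    x≉const : NonConst x
    x≉const = All.lookup (proj₁ (proj₂ dec-P) m Pm) x∈RPm

    x∼RPm : Any (Assoc x) (RP m)
    x∼RPm = Any.map (λ { ≡.refl → IsEquivalence.refl Assoc-isEquivalence }) x∈RPm

    some-gate-lacks-x : ¬ ¬ ∃ λ g → SP g ≡ true × ¬ Any (Assoc x) (RP g)
    some-gate-lacks-x = ¬¬-map (λ (g , ¬[Pg→x∈RPg]) → g , ¬[≡true→A]⇒≡true×¬A (SP g) ¬[Pg→x∈RPg])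
      (¬∀⇒¬¬∃¬ λ x∈all → proj₂ (proj₂ (proj₂ dec-P)) (x , x∈all))

    gi≤cg : ∀ {g ca cb cg gi gj gQ} → SP g ≡ true →
      Count x (C a) ca → Count x (C b) cb → Count x (C g) cg →
      Count x Gi gi → Count x Gj gj → Count x GQ gQ → gi ≤ cg
    gi≤cg {g} {ca} {cb} {cg} {gi} {gj} {gQ} Pg #a #b #g #i #j #Q with P⊆i∪j g Pg
    ... | inj₁ ig = gcd-count-≤ dec-i x≉const ig #g #i
    ... | inj₂ jg = begin
      gi  ≤⟨ gcd-count-≤ dec-i x≉const ia #a #i ⟩
      ca  ≡⟨ gcd-count-≡ dec-Q x≉const Qa #a #Q (none ∘ inj₂ ∘ inj₁) ⟩
      gQ  ≤⟨ gcd-count-≤ dec-Q x≉const Qb #b #Q ⟩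
      cb  ≡⟨ gcd-count-≡ dec-j x≉const jb #b #j (none ∘ inj₂ ∘ inj₂) ⟩
      gj  ≤⟨ gcd-count-≤ dec-j x≉const jg #g #j ⟩
      cg  ∎

  SynRank-bridge-≤ : ∀ {k} {C : Circuit k} {Si Sj SQ SP : Selector k} {di dj dQ dP} →
    SynRank C Si di → SynRank C Sj dj → SynRank C SQ dQ → SynRank C SP dP →
    (∀ g → SP g ≡ true → Si g ≡ true ⊎ Sj g ≡ true) →
    ∀ {a b} → Si a ≡ true → SQ a ≡ true → Sj b ≡ true → SQ b ≡ true →
    dP ≤ di ℕ.+ dQ ℕ.+ dj
  SynRank-bridge-≤ {Si = Si} {Sj} {SQ} {SP}
    (_ , Ri , dec-i , Bi , ≡.refl , _ , _ , Ri⊆Bi) (_ , Rj , dec-j , Bj , ≡.refl , _ , _ , Rj⊆Bj)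
    (_ , RQ , dec-Q , BQ , ≡.refl , _ , _ , RQ⊆BQ) (_ , RP , dec-P , BP , ≡.refl , BP-indep , BP⊆RP , _)
    P⊆i∪j ia Qa jb Qb =
    decidable-stable (_ ℕ.≤? _) do
      RP⊆W ← ¬¬-Π λ u → RP-in-W (∈-lookup u)
      pure (LinIndepᶠ-InSpanᶠ⇒≤ (lookup BP) W (LinIndep⇒LinIndepᶠ {BP} BP-indep)
             λ u → InSpanᶠ-trans (InSpan⇒InSpanᶠ {L = collect SP RP} (All.lookup BP⊆RP (∈-lookup u))) RP⊆W)
    where
    W : Fin (length Bi ℕ.+ length BQ ℕ.+ length Bj) → Affine
    W = (lookup Bi Vector.++ lookup BQ) Vector.++ lookup Bj

    InSpanᶠ-W-i : ∀ {x} → InSpanᶠ x (lookup Bi) → InSpanᶠ x W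
    InSpanᶠ-W-i = InSpanᶠ-++ˡ _ (lookup Bj) ∘ InSpanᶠ-++ˡ (lookup Bi) (lookup BQ)
    InSpanᶠ-W-Q : ∀ {x} → InSpanᶠ x (lookup BQ) → InSpanᶠ x W
    InSpanᶠ-W-Q = InSpanᶠ-++ˡ _ (lookup Bj) ∘ InSpanᶠ-++ʳ (lookup Bi) (lookup BQ)
    InSpanᶠ-W-j : ∀ {x} → InSpanᶠ x (lookup Bj) → InSpanᶠ x W
    InSpanᶠ-W-j = InSpanᶠ-++ʳ (lookup Bi Vector.++ lookup BQ) (lookup Bj)

    part-InSpanᶠ : ∀ S R B {g x} → All (λ v → InSpan v B) (collect S R) →
      S g ≡ true → Any (Assoc x) (R g) → InSpanᶠ x (lookup B)
    part-InSpanᶠ S R B R⊆B Sg x∼Rg with (y∈B , x∼y) ← All.lookupAny R⊆B (collect-Any⁺ S R Sg x∼Rg) =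
      Assoc-InSpanᶠ x∼y (InSpan⇒InSpanᶠ {L = B} y∈B)

    i-InSpanᶠ-W : ∀ {g x} → Si g ≡ true → Any (Assoc x) (Ri g) → InSpanᶠ x W
    i-InSpanᶠ-W ig = InSpanᶠ-W-i ∘ part-InSpanᶠ Si Ri Bi Ri⊆Bi ig
    Q-InSpanᶠ-W : ∀ {g x} → SQ g ≡ true → Any (Assoc x) (RQ g) → InSpanᶠ x W
    Q-InSpanᶠ-W Qg = InSpanᶠ-W-Q ∘ part-InSpanᶠ SQ RQ BQ RQ⊆BQ Qg
    j-InSpanᶠ-W : ∀ {g x} → Sj g ≡ true → Any (Assoc x) (Rj g) → InSpanᶠ x W
    j-InSpanᶠ-W jg = InSpanᶠ-W-j ∘ part-InSpanᶠ Sj Rj Bj Rj⊆Bj jg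

    RP-in-W : ∀ {x} → x ∈ collect SP RP → ¬ ¬ InSpanᶠ x W
    RP-in-W x∈ with collect-∈⁻ SP RP x∈
    ... | m , Pm , x∈RPm with P⊆i∪j m Pm
    ...   | inj₁ im = ¬¬-map Sum.[ i-InSpanᶠ-W im , Sum.[ Q-InSpanᶠ-W Qa , j-InSpanᶠ-W jb ] ]
                        (merged-factor-∈-parts dec-i dec-j dec-Q dec-P P⊆i∪j ia Qa jb Qb Pm im x∈RPm)
    ...   | inj₂ jm = ¬¬-map Sum.[ j-InSpanᶠ-W jm , Sum.[ Q-InSpanᶠ-W Qb , i-InSpanᶠ-W ia ] ]
                        (merged-factor-∈-parts dec-j dec-i dec-Q dec-P (λ g → Sum.swap ∘ P⊆i∪j g)
                           jb Qb ia Qa Pm jm x∈RPm)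

  syntactic-partition-refines : ∀ {k s s′} {C : Circuit k} {τ rC rD}
    {p : Fin k → Fin s} {q : Fin k → Fin s′} → ℕtoℚ 3 ℚ.≤ τ →
    IsSyntacticPartition C τ rC p → IsSyntacticPartition C τ rD q → rD ℕ.< rC →
    ∀ a b → q a ≡ q b → p a ≡ p b
  syntactic-partition-refines {rC = rC} {rD} {p} {q} 3≤τ (_ , rank-p , dist-p) (_ , rank-q , _) rD<rC a b qa≡qb
    with p a Fin.≟ p b
  ... | yes pa≡pb = pa≡pb
  ... | no pa≢pb
    with (di , rank-i , di≤rC) ← rank-p (p a)
    with (dj , rank-j , dj≤rC) ← rank-p (p b)
    with (dQ , rank-Q , dQ≤rD) ← rank-q (q a)
    with (dP , rank-P , τrC≤dP) ← dist-p (p a) (p b) pa≢pb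
    = ⊥-elim (ℕ.<-irrefl ≡.refl (begin-strict
      3 ℕ.* rC                ≤⟨ scaled-≤⇒*-≤ 3 rC dP 3≤τ τrC≤dP ⟩
      dP                      ≤⟨ SynRank-bridge-≤ rank-i rank-j rank-Q rank-P (λ g → ∨≡true⇒ _ _)
                                   (∈-own-cluster (p a)) (∈-own-cluster (q a)) (∈-own-cluster (p b)) (dec-true (q b Fin.≟ q a) (≡.sym qa≡qb)) ⟩
      di ℕ.+ dQ ℕ.+ dj        ≤⟨ ℕ.+-mono-≤ (ℕ.+-mono-≤ di≤rC dQ≤rD) dj≤rC ⟩
      rC ℕ.+ rD ℕ.+ rC        <⟨ ℕ.+-monoˡ-< rC (ℕ.+-monoʳ-< rC rD<rC) ⟩
      rC ℕ.+ rC ℕ.+ rC        ≡⟨ ℕ.+-assoc rC rC rC ⟩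
      rC ℕ.+ (rC ℕ.+ rC)      ≡⟨ ≡.cong (λ t → rC ℕ.+ (rC ℕ.+ t)) (≡.sym (ℕ.+-identityʳ rC)) ⟩
      3 ℕ.* rC                ∎))
    where
    open ℕ.≤-Reasoning
    ∈-own-cluster : ∀ {m} (i : Fin m) → does (i Fin.≟ i) ≡ true
    ∈-own-cluster i = dec-true (i Fin.≟ i) ≡.refl


corollary4p7 : ∀ {c ℓ : Level} (F : Field c ℓ) (n k : ℕ) (C : Circuits.Circuit F n k) (τ : ℚ) →
    ℕtoℚ 10 ℚ.≤ τ →
    Circuits.IsMinimal F n C →
    Circuits.IsMultilinearCircuit F n C →
    ∀ (s : ℕ) (p : Fin k → Fin s) (rC : ℕ) →
    Circuits.IsSyntacticPartition F n C τ rC p →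
    (∀ (s' : ℕ) (p' : Fin k → Fin s') →
       Circuits.IsτSyntacticPartition F n C τ p' → s' ≤ s) →
    ∀ (s' : ℕ) (q : Fin k → Fin s') (rD : ℕ) →
    Circuits.IsSyntacticPartition F n C τ rD q →
    ¬ Circuits.SamePartition F n p q →
    rC ≤ rD
corollary4p7 F n k C τ 10≤τ _ _ s p rC p-syn p-maximal s′ q rD q-syn p≉q =
  decidable-stable (rC ℕ.≤? rD) λ rC≰rD →
    p≉q (refines∧≤⇒same-blocks p q (proj₁ p-syn) (proj₁ q-syn)
          (syntactic-partition-refines F n 3≤τ p-syn q-syn (ℕ.≰⇒> rC≰rD))
          (p-maximal s′ q (rD , q-syn)))
  where
  3≤τ : ℕtoℚ 3 ℚ.≤ τ
  3≤τ = ℚ.≤-trans (from-yes (ℕtoℚ 3 ℚ.≤? ℕtoℚ 10)) 10≤τ
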